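{- Let $G$ be a connected graph and $k \ge 3$. Then $F(G \,\square\, K_k) = \alpha(G \,\square\, K_k)$. In particular, $F(G \,\square\, K_k) = |V(G)|$ when $k \ge \chi(G)$.
   Context: Peg solitaire on a graph: a configuration assigns to each vertex either a peg or a hole. If $x,y,z$ form a path $xyz$ with pegs at $x$ and $y$ and a hole at $z$, a jump $xyz$ removes the pegs at $x$ and $y$ and places a peg at $z$. A terminal state of a graph $G$ is the set of peg locations when no jump is available, reached by some sequence of jumps from a starting configuration with exactly one hole (and pegs on all other vertices). The fool's solitaire number $F(G)$ is the maximum size of a terminal state of $G$. $\alpha$ is the independence number and $\chi$ the chromatic number. The cartesian product $G \,\square\, H$ has vertex set $V(G)\times V(H)$, two vertices being adjacent iff they are equal in one coordinate and adjacent in the other. -}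

module Defs where

open import Data.Nat using (ℕ; _≤_; NonZero)
open import Data.Fin using (Fin; remQuot)
open import Data.Fin.Subset using (Subset; _∈_; _∉_; ⁅_⁆; ∁; ∣_∣; inside; outside)
open import Data.Vec using (_[_]≔_)
open import Data.Product using (Σ; ∃; ∃-syntax; _×_; _,_; proj₁; proj₂)
open import Data.Sum using (_⊎_)
open import Relation.Nullary using (¬_)
open import Relation.Binary.PropositionalEquality using (_≡_; _≢_)
open import Relation.Binary.Construct.Closure.ReflexiveTransitive using (Star)

record Graph : Set₁ where
  field
    n   : ℕ
    Adj : Fin n → Fin n → Set
open Graph public

record IsSimpleGraph (G : Graph) : Set where
  field
    adj-sym    : ∀ {u v} → Adj G u v → Adj G v u
    adj-irrefl : ∀ {u} → ¬ Adj G u u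
    adj-dec    : ∀ u v → Adj G u v ⊎ ¬ Adj G u v

Connected : Graph → Set
Connected G = NonZero (n G) × (∀ u v → Star (Adj G) u v)

K : ℕ → Graph
K k = record { n = k ; Adj = λ i j → i ≢ j }

-- Cartesian product G □ H; vertex p of Fin (n G * n H) encodes the pair remQuot (n H) p.
_□_ : Graph → Graph → Graph
G □ H = record
  { n   = n G Data.Nat.* n H
  ; Adj = λ p q →
      let a = proj₁ (remQuot {n G} (n H) p) ; i = proj₂ (remQuot {n G} (n H) p)
          b = proj₁ (remQuot {n G} (n H) q) ; j = proj₂ (remQuot {n G} (n H) q)
      in (a ≡ b × Adj H i j) ⊎ (i ≡ j × Adj G a b)
  }

-- Configurations: the set of vertices carrying a peg.
Config : Graph → Set
Config G = Subset (n G)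

JumpAt : (G : Graph) → Config G → Fin (n G) → Fin (n G) → Fin (n G) → Set
JumpAt G c x y z = Adj G x y × Adj G y z × x ≢ z × x ∈ c × y ∈ c × z ∉ c

data Jump (G : Graph) : Config G → Config G → Set where
  jump : ∀ {c} x y z → JumpAt G c x y z →
         Jump G c (((c [ x ]≔ outside) [ y ]≔ outside) [ z ]≔ inside)

JumpAvailable : (G : Graph) → Config G → Set
JumpAvailable G c = ∃[ x ] ∃[ y ] ∃[ z ] JumpAt G c x y z

IsTerminalState : (G : Graph) → Config G → Set
IsTerminalState G S =
  (∃[ v ] Star (Jump G) (∁ ⁅ v ⁆) S) × ¬ JumpAvailable G S

IsFoolsSolitaireNumber : Graph → ℕ → Set
IsFoolsSolitaireNumber G m =
  (∃[ S ] IsTerminalState G S × ∣ S ∣ ≡ m) ×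
  (∀ S → IsTerminalState G S → ∣ S ∣ ≤ m)

IsIndependent : (G : Graph) → Subset (n G) → Set
IsIndependent G S = ∀ x y → x ∈ S → y ∈ S → ¬ Adj G x y

IsIndependenceNumber : Graph → ℕ → Set
IsIndependenceNumber G m =
  (∃[ S ] IsIndependent G S × ∣ S ∣ ≡ m) ×
  (∀ S → IsIndependent G S → ∣ S ∣ ≤ m)

ProperColoring : (G : Graph) (c : ℕ) → (Fin (n G) → Fin c) → Set
ProperColoring G c f = ∀ x y → Adj G x y → f x ≢ f y

IsChromaticNumber : Graph → ℕ → Set
IsChromaticNumber G c =
  (∃[ f ] ProperColoring G c f) ×
  (∀ c' → (∃[ f ] ProperColoring G c' f) → c ≤ c')

module Submission where

-- A jump always leaves a hole, so every state reached from a single hole has one.  If a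
-- terminal state had two adjacent pegs, the fibre {b} × K k of the second one would be full
-- (the pair could jump into any of its holes), a full fibre forces every neighbouring fibre
-- to be full, and by connectivity the whole board would be full.  Hence terminal states are
-- independent and F ≤ α.  Conversely every nonempty independent set S is a terminal state:
-- collapse the fibre of a vertex r onto its peg in S and walk through G depth first.
-- Entering a child whose fibre is still full leaves a single peg there (jumps across the
-- edge, then jumps inside K k, which needs k ≥ 3); once the child's subtree is done its
-- fibre is turned into its part of S while the parent again holds a single peg.  Finally an
-- independent set has at most one peg per fibre, and a proper colouring c with at most k
-- colours gives the independent set {(a , c a)}, so α = |V(G)| when χ(G) ≤ k.

open import Defs
open import Data.Bool using (Bool; true; false; not; if_then_else_)
open import Data.Bool.Properties using (¬-not; not-injective) renaming (_≟_ to _≟ᵇ_)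
open import Data.Fin using (Fin; zero; suc; combine; remQuot; _↑ˡ_; _↑ʳ_; inject≤; fromℕ<)
open import Data.Fin.Properties using (_≟_; remQuot-combine; combine-remQuot; combine-injective; any?; all?; inject≤-injective)
open import Data.Vec using ([]; _∷_; tabulate; lookup; _[_]≔_)
open import Data.Vec.Properties using (lookup∘tabulate; tabulate∘lookup; tabulate-cong; lookup∘update; lookup∘update′; lookup⇒[]=; []=⇒lookup)
open import Data.Fin.Subset using (Subset; _∈_; _∉_; inside; outside; ∣_∣; ⁅_⁆; ∁; ⊥)
open import Data.Fin.Subset.Properties using (∣p∣≤n; anySubset?; x∈⁅x⁆; x∈⁅y⁆⇒x≡y; x∈p⇒x∉∁p; x∉p⇒x∈∁p; _∈?_; ∉⊥; ∣⁅x⁆∣≡1)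
open import Relation.Binary.Construct.Closure.ReflexiveTransitive using (Star; ε; _◅_; _◅◅_)
open import Data.Nat using (ℕ; zero; suc; _+_; _*_; _≤_; _<_; _<?_; z≤n; s≤s; NonZero; >-nonZero⁻¹)
open import Data.Nat.Properties using (≤-refl; ≤-antisym; m≤n⇒m≤1+n; suc-injective; ≤-trans; ≤-pred; n≤0⇒n≡0; +-mono-≤; +-monoʳ-≤; +-suc; m≤m+n; ≮⇒≥)
open import Data.Product using (Σ; ∃-syntax; _×_; _,_; proj₁; proj₂; uncurry)
open import Data.Sum using (_⊎_; inj₁; inj₂)
open import Function using (_∘_)
open import Data.List using (List; []; _∷_; allFin)
open import Data.List.Membership.Propositional using () renaming (_∈_ to _∈ₗ_)
open import Data.List.Membership.Propositional.Properties using (∈-allFin)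
open import Data.List.Relation.Unary.Any using (here; there)
open import Relation.Nullary using (¬_; Dec; yes; no; does; contradiction)
open import Relation.Nullary.Decidable using (dec-true; dec-false; _×-dec_; _⊎-dec_; _→-dec_; ¬?)
open import Relation.Binary.PropositionalEquality

-- Boolean vectors: updates and peg counts

set : ∀ {n} → (Fin n → Bool) → Fin n → Bool → Fin n → Bool
set φ i b z = if does (z ≟ i) then b else φ z

_⊖_ _⊕_ : ∀ {n} → (Fin n → Bool) → Fin n → Fin n → Bool
φ ⊖ i = set φ i false
φ ⊕ i = set φ i true
infixl 6 _⊖_ _⊕_

full empty : ∀ {n} → Fin n → Bool
full _ = true
empty _ = false

one : ∀ {n} → Fin n → Fin n → Bool
one m z = does (z ≟ m)

two : ∀ {n} → Fin n → Fin n → Fin n → Bool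
two m x = one m ⊕ x

set-≡ : ∀ {n} (φ : Fin n → Bool) i b → set φ i b i ≡ b
set-≡ φ i b rewrite dec-true (i ≟ i) refl = refl

set-≢ : ∀ {n} (φ : Fin n → Bool) {i z} b → z ≢ i → set φ i b z ≡ φ z
set-≢ φ {i} {z} b z≢i rewrite dec-false (z ≟ i) z≢i = refl

set-cong : ∀ {n} {φ ψ : Fin n → Bool} → φ ≗ ψ → ∀ i b → set φ i b ≗ set ψ i b
set-cong φ≗ψ i b z = cong (if does (z ≟ i) then b else_) (φ≗ψ z)

one-≡ : ∀ {n} (m : Fin n) → one m m ≡ true
one-≡ m = dec-true (m ≟ m) refl

one-≢ : ∀ {n} {m z : Fin n} → z ≢ m → one m z ≡ false
one-≢ {m = m} {z} = dec-false (z ≟ m)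

one-true : ∀ {n} (m z : Fin n) → one m z ≡ true → z ≡ m
one-true m z eq with z ≟ m
... | yes z≡m = z≡m

⊖-hole : ∀ {n} (φ : Fin n → Bool) i z → φ z ≡ false → (φ ⊖ i) z ≡ false
⊖-hole φ i z φz with z ≟ i
... | yes _ = refl
... | no _  = φz

⊕-peg : ∀ {n} (φ : Fin n → Bool) i z → φ z ≡ true → (φ ⊕ i) z ≡ true
⊕-peg φ i z φz with z ≟ i
... | yes _ = refl
... | no _  = φz

⊖-comm : ∀ {n} (φ : Fin n → Bool) i j → φ ⊖ i ⊖ j ≗ φ ⊖ j ⊖ i
⊖-comm φ i j z with z ≟ i | z ≟ j
... | yes _ | yes _ = refl
... | yes _ | no _  = refl
... | no _  | yes _ = refl
... | no _  | no _  = refl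

one-shift : ∀ {n} (i l : Fin n) → one i ⊖ i ⊕ l ≗ one l
one-shift i l z with z ≟ l | z ≟ i
... | yes _ | _     = refl
... | no _  | yes _ = refl
... | no _  | no _  = refl

two-⊖ : ∀ {n} {m x : Fin n} → x ≢ m → two m x ⊖ m ≗ one x
two-⊖ {m = m} {x} x≢m z with z ≟ m | z ≟ x
... | yes refl | yes refl = contradiction refl x≢m
... | yes _    | no _     = refl
... | no _     | yes _    = refl
... | no _     | no _     = refl

two-fst : ∀ {n} (m x : Fin n) → two m x m ≡ true
two-fst m x with m ≟ x
... | yes _ = refl
... | no _  = one-≡ m

peg≢hole : ∀ {n} (φ : Fin n → Bool) {i j} → φ i ≡ true → φ j ≡ false → i ≢ j
peg≢hole φ φi φj refl = contradiction (trans (sym φi) φj) λ ()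

contraposeᵇ : ∀ {a b : Bool} → (a ≡ true → b ≡ true) → b ≡ false → a ≡ false
contraposeᵇ {false} _   _  = refl
contraposeᵇ {true}  a⇒b b≡false = contradiction (trans (sym (a⇒b refl)) b≡false) λ ()

count : ∀ {n} → (Fin n → Bool) → ℕ
count {zero}  φ = 0
count {suc n} φ = if φ zero then suc (count (φ ∘ suc)) else count (φ ∘ suc)

count-cong : ∀ {n} {φ ψ : Fin n → Bool} → φ ≗ ψ → count φ ≡ count ψ
count-cong {zero}  φ≗ψ = refl
count-cong {suc n} φ≗ψ rewrite φ≗ψ zero | count-cong (φ≗ψ ∘ suc) = refl

count-⊖ : ∀ {n} (φ : Fin n → Bool) i → φ i ≡ true → count φ ≡ suc (count (φ ⊖ i))
count-⊖ {suc n} φ zero    φi rewrite φi = refl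
count-⊖ {suc n} φ (suc i) φi with φ zero
... | true  = cong suc (count-⊖ (φ ∘ suc) i φi)
... | false = count-⊖ (φ ∘ suc) i φi

⊕-⊖ : ∀ {n} (φ : Fin n → Bool) {i} → φ i ≡ false → φ ⊕ i ⊖ i ≗ φ
⊕-⊖ φ {i} φi z with z ≟ i
... | yes refl = sym φi
... | no _     = refl

count-⊕ : ∀ {n} (φ : Fin n → Bool) i → φ i ≡ false → count (φ ⊕ i) ≡ suc (count φ)
count-⊕ φ i φi = trans (count-⊖ (φ ⊕ i) i (set-≡ φ i true)) (cong suc (count-cong (⊕-⊖ φ φi)))

count-full : ∀ {n} → count (full {n}) ≡ n
count-full {zero}  = refl
count-full {suc n} = cong suc (count-full {n})

count-empty : ∀ {n} → count (empty {n}) ≡ 0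
count-empty {zero}  = refl
count-empty {suc n} = count-empty {n}

one-⊖ : ∀ {n} (m : Fin n) → one m ⊖ m ≗ empty
one-⊖ m z with z ≟ m
... | yes _ = refl
... | no _  = refl

count-one : ∀ {n} (m : Fin n) → count (one m) ≡ 1
count-one {n} m = trans (count-⊖ (one m) m (one-≡ m)) (cong suc (trans (count-cong (one-⊖ m)) (count-empty {n})))

count≡0⇒hole : ∀ {n} (φ : Fin n → Bool) → count φ ≡ 0 → ∀ i → φ i ≡ false
count≡0⇒hole {suc n} φ c≡0 i with φ zero in φ0
count≡0⇒hole {suc n} φ c≡0 zero    | false = φ0
count≡0⇒hole {suc n} φ c≡0 (suc i) | false = count≡0⇒hole (φ ∘ suc) c≡0 i

count≤n : ∀ {n} (φ : Fin n → Bool) → count φ ≤ n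
count≤n {zero}  φ = z≤n
count≤n {suc n} φ with φ zero
... | true  = s≤s (count≤n (φ ∘ suc))
... | false = m≤n⇒m≤1+n (count≤n (φ ∘ suc))

count-mono : ∀ {n} {φ ψ : Fin n → Bool} → (∀ i → φ i ≡ true → ψ i ≡ true) → count φ ≤ count ψ
count-mono {zero} φ⊆ψ = z≤n
count-mono {suc n} {φ} {ψ} φ⊆ψ with φ zero in φ0 | ψ zero in ψ0
... | true  | true  = s≤s (count-mono (φ⊆ψ ∘ suc))
... | true  | false = contradiction (trans (sym (φ⊆ψ zero φ0)) ψ0) λ ()
... | false | true  = m≤n⇒m≤1+n (count-mono (φ⊆ψ ∘ suc))
... | false | false = count-mono (φ⊆ψ ∘ suc)

some-peg : ∀ {n} (φ : Fin n → Bool) → 0 < count φ → ∃[ i ] φ i ≡ true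
some-peg {suc n} φ 0<c with φ zero in φ0
... | true  = zero , φ0
... | false = let i , φi = some-peg (φ ∘ suc) 0<c in suc i , φi

two-pegs : ∀ {n} (φ : Fin n → Bool) → 2 ≤ count φ → ∃[ i ] ∃[ j ] i ≢ j × φ i ≡ true × φ j ≡ true
two-pegs φ 2≤c with some-peg φ (≤-trans (s≤s z≤n) 2≤c)
... | i , φi with some-peg (φ ⊖ i) (≤-pred (subst (2 ≤_) (count-⊖ φ i φi) 2≤c))
... | j , φ⊖ij = i , j , i≢j , φi , trans (sym (set-≢ φ false (i≢j ∘ sym))) φ⊖ij
  where
  i≢j : i ≢ j
  i≢j refl = contradiction (trans (sym φ⊖ij) (set-≡ φ i false)) λ ()

count≡1⇒one : ∀ {n} (φ : Fin n → Bool) {t} → count φ ≡ 1 → φ t ≡ true → φ ≗ one t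
count≡1⇒one φ {t} c≡1 φt z with z ≟ t
... | yes refl = φt
... | no z≢t   = trans (sym (set-≢ φ false z≢t)) (count≡0⇒hole (φ ⊖ t) (suc-injective (trans (sym (count-⊖ φ t φt)) c≡1)) z)

count-full⊖ : ∀ {n} (i : Fin n) → suc (count (full ⊖ i)) ≡ n
count-full⊖ {n} i = trans (sym (count-⊖ full i refl)) (count-full {n})

count-⊖⊖ : ∀ {n} (φ : Fin n → Bool) {i j} → i ≢ j → φ i ≡ true → φ j ≡ true → count φ ≡ 2 + count (φ ⊖ i ⊖ j)
count-⊖⊖ φ {i} {j} i≢j φi φj = trans (count-⊖ φ i φi) (cong suc (count-⊖ (φ ⊖ i) j (trans (set-≢ φ false (i≢j ∘ sym)) φj)))

count-full⊖⊖ : ∀ {n} {i j : Fin n} → i ≢ j → 2 + count (full ⊖ i ⊖ j) ≡ n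
count-full⊖⊖ {n} i≢j = trans (sym (count-⊖⊖ full i≢j refl refl)) (count-full {n})

count-↑ : ∀ m {n} (φ : Fin (m + n) → Bool) → count φ ≡ count (φ ∘ (_↑ˡ n)) + count (φ ∘ (m ↑ʳ_))
count-↑ zero    φ = refl
count-↑ (suc m) φ with φ zero
... | true  = cong suc (count-↑ m (φ ∘ suc))
... | false = count-↑ m (φ ∘ suc)

count-blocks≤ : ∀ M {k} (φ : Fin (M * k) → Bool) → (∀ a → count (φ ∘ combine {M} {k} a) ≤ 1) → count φ ≤ M
count-blocks≤ zero    φ _ = z≤n
count-blocks≤ (suc M) {k} φ blocks≤1 =
  subst (_≤ suc M) (sym (count-↑ k φ)) (+-mono-≤ (blocks≤1 zero) (count-blocks≤ M (φ ∘ (k ↑ʳ_)) (blocks≤1 ∘ suc)))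

count-blocks≡ : ∀ M {k} (φ : Fin (M * k) → Bool) → (∀ a → count (φ ∘ combine {M} {k} a) ≡ 1) → count φ ≡ M
count-blocks≡ zero    φ _ = refl
count-blocks≡ (suc M) {k} φ blocks≡1 =
  trans (count-↑ k φ) (cong₂ _+_ (blocks≡1 zero) (count-blocks≡ M (φ ∘ (k ↑ʳ_)) (blocks≡1 ∘ suc)))

∣∣≡count : ∀ {n} (S : Subset n) → ∣ S ∣ ≡ count (lookup S)
∣∣≡count []          = refl
∣∣≡count (true ∷ S)  = cong suc (∣∣≡count S)
∣∣≡count (false ∷ S) = ∣∣≡count S

maximum : ∀ {n} {P : Subset n → Set} → (∀ S → Dec (P S)) → ∀ {S} → P S →
          ∃[ M ] P M × (∀ S → P S → ∣ S ∣ ≤ ∣ M ∣)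
maximum {n} {P} P? {S} PS = search n S PS (m≤m+n n ∣ S ∣)
  where
  search : ∀ d S → P S → n ≤ d + ∣ S ∣ → ∃[ M ] P M × (∀ S → P S → ∣ S ∣ ≤ ∣ M ∣)
  search zero    S PS n≤∣S∣ = S , PS , λ S′ _ → ≤-trans (∣p∣≤n S′) n≤∣S∣
  search (suc d) S PS bound with anySubset? (λ S′ → P? S′ ×-dec (∣ S ∣ <? ∣ S′ ∣))
  ... | yes (S′ , PS′ , S<S′) =
    search d S′ PS′ (≤-trans bound (subst (_≤ d + ∣ S′ ∣) (+-suc d ∣ S ∣) (+-monoʳ-≤ d S<S′)))
  ... | no  none              = S , PS , λ S′ PS′ → ≮⇒≥ λ S<S′ → none (S′ , PS′ , S<S′)

hole-after-jump : ∀ {G A B} → Jump G A B → ∃[ p ] p ∉ B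
hole-after-jump {A = A} (jump x y z (_ , _ , x≢z , _)) =
  x , λ x∈B → contradiction (trans (sym ([]=⇒lookup x∈B)) (trans (lookup∘update′ x≢z A′ inside) (vacated (x ≟ y)))) λ ()
  where
  A′ = (A [ x ]≔ outside) [ y ]≔ outside
  vacated : Dec (x ≡ y) → lookup A′ x ≡ outside
  vacated (yes refl) = lookup∘update x (A [ x ]≔ outside) outside
  vacated (no x≢y)   = trans (lookup∘update′ x≢y (A [ x ]≔ outside) outside) (lookup∘update x A outside)

holes-persist : ∀ {G A B} → Star (Jump G) A B → ∃[ p ] p ∉ A → ∃[ p ] p ∉ B
holes-persist ε        hole = hole
holes-persist (j ◅ js) _    = holes-persist js (hole-after-jump j)

module Colours (k′ : ℕ) where

  other : Fin (3 + k′) → Fin (3 + k′)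
  other zero    = suc zero
  other (suc _) = zero

  other≢ : ∀ m → other m ≢ m
  other≢ zero    ()
  other≢ (suc _) ()

  third : Fin (3 + k′) → Fin (3 + k′) → Fin (3 + k′)
  third zero          zero          = suc zero
  third zero          (suc zero)    = suc (suc zero)
  third zero          (suc (suc _)) = suc zero
  third (suc zero)    zero          = suc (suc zero)
  third (suc zero)    (suc _)       = zero
  third (suc (suc _)) zero          = suc zero
  third (suc (suc _)) (suc _)       = zero

  third≢ˡ : ∀ m x → third m x ≢ m
  third≢ˡ zero          zero          ()
  third≢ˡ zero          (suc zero)    ()
  third≢ˡ zero          (suc (suc _)) ()
  third≢ˡ (suc zero)    zero          ()
  third≢ˡ (suc zero)    (suc _)       ()
  third≢ˡ (suc (suc _)) zero          ()
  third≢ˡ (suc (suc _)) (suc _)       ()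

  third≢ʳ : ∀ m x → third m x ≢ x
  third≢ʳ zero          zero          ()
  third≢ʳ zero          (suc zero)    ()
  third≢ʳ zero          (suc (suc _)) ()
  third≢ʳ (suc zero)    zero          ()
  third≢ʳ (suc zero)    (suc _)       ()
  third≢ʳ (suc (suc _)) zero          ()
  third≢ʳ (suc (suc _)) (suc _)       ()

module Board (G : Graph) (simple : IsSimpleGraph G) (k′ : ℕ) where

  open IsSimpleGraph simple
  open Colours k′

  k : ℕ
  k = 3 + k′

  V C : Set
  V = Fin (n G)
  C = Fin k

  H : Graph
  H = G □ K k

  Fibre Board : Set
  Fibre = C → Bool
  Board = V → Fibre

  cell : V → C → Fin (n H)
  cell = combine

  cell-injective : ∀ {a i b j} → cell a i ≡ cell b j → (a , i) ≡ (b , j)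
  cell-injective {a} {i} {b} {j} eq with combine-injective a i b j eq
  ... | refl , refl = refl

  coords : Fin (n H) → V × C
  coords = remQuot {n G} k

  cell-coords : ∀ p → uncurry cell (coords p) ≡ p
  cell-coords = combine-remQuot {n G} k

  Adjacent : V × C → V × C → Set
  Adjacent (a , i) (b , j) = (a ≡ b × i ≢ j) ⊎ (i ≡ j × Adj G a b)

  Adj-cell : ∀ {a i b j} → Adjacent (a , i) (b , j) → Adj H (cell a i) (cell b j)
  Adj-cell {a} {i} {b} {j} = subst₂ Adjacent (sym (remQuot-combine a i)) (sym (remQuot-combine b j))

  adj≢ : ∀ {a b} → Adj G a b → a ≢ b
  adj≢ ab refl = adj-irrefl ab

  spread : Connected G → {P : V → Set} → (∀ {a b} → Adj G a b → P a → P b) → ∀ {a} → P a → ∀ b → P b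
  spread (_ , path) {P} step {a} Pa b = along (path a b) Pa
    where
    along : ∀ {x y} → Star (Adj G) x y → P x → P y
    along ε       Px = Px
    along (e ◅ w) Px = along w (step e Px)

  encode : Board → Config H
  encode c = tabulate λ p → uncurry c (coords p)

  view : Config H → Board
  view S a i = lookup S (cell a i)

  view-encode : ∀ c a i → view (encode c) a i ≡ c a i
  view-encode c a i = trans (lookup∘tabulate _ (cell a i)) (cong (uncurry c) (remQuot-combine a i))

  config-ext : ∀ {S S′ : Config H} → (∀ a i → view S a i ≡ view S′ a i) → S ≡ S′
  config-ext {S} {S′} eq = begin
    S                     ≡⟨ tabulate∘lookup S ⟨
    tabulate (lookup S)   ≡⟨ tabulate-cong (λ p → subst (λ q → lookup S q ≡ lookup S′ q) (cell-coords p) (uncurry eq (coords p))) ⟩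
    tabulate (lookup S′)  ≡⟨ tabulate∘lookup S′ ⟩
    S′                    ∎
    where open ≡-Reasoning

  encode-cong : ∀ {c d : Board} → (∀ a → c a ≗ d a) → encode c ≡ encode d
  encode-cong {c} {d} c≈d = config-ext λ a i → trans (view-encode c a i) (trans (c≈d a i) (sym (view-encode d a i)))

  encode-view : ∀ S → encode (view S) ≡ S
  encode-view S = config-ext (view-encode (view S))

  ∈⇒view : ∀ {S p} → p ∈ S → uncurry (view S) (coords p) ≡ true
  ∈⇒view {S} {p} p∈S = trans (cong (lookup S) (cell-coords p)) ([]=⇒lookup p∈S)

  view⇒∈ : ∀ {S a i} → view S a i ≡ true → cell a i ∈ S
  view⇒∈ {S} {a} {i} = lookup⇒[]= (cell a i) S

  ∉⇒view : ∀ {S a i} → cell a i ∉ S → view S a i ≡ false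
  ∉⇒view ai∉S = ¬-not λ Sai → ai∉S (view⇒∈ Sai)

  setCell : Board → V → C → Bool → Board
  setCell c a i b v = if does (v ≟ a) then set (c v) i b else c v

  setCell-here : ∀ c a i b → setCell c a i b a ≡ set (c a) i b
  setCell-here c a i b rewrite dec-true (a ≟ a) refl = refl

  setCell-there : ∀ c {a} i b {v} → v ≢ a → setCell c a i b v ≡ c v
  setCell-there c {a} i b {v} v≢a rewrite dec-false (v ≟ a) v≢a = refl

  encode-setCell : ∀ c a i b → encode (setCell c a i b) ≡ encode c [ cell a i ]≔ b
  encode-setCell c a i b = config-ext λ a′ i′ → trans (view-encode _ a′ i′) (pointwise a′ i′ (a′ ≟ a) (i′ ≟ i))
    where
    pointwise : ∀ a′ i′ → Dec (a′ ≡ a) → Dec (i′ ≡ i) → setCell c a i b a′ i′ ≡ view (encode c [ cell a i ]≔ b) a′ i′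
    pointwise a′ i′ (yes refl) (yes refl) =
      trans (cong (λ φ → φ i′) (setCell-here c a′ i′ b))
            (trans (set-≡ (c a′) i′ b) (sym (lookup∘update (cell a′ i′) (encode c) b)))
    pointwise a′ i′ (yes refl) (no i′≢i) =
      trans (cong (λ φ → φ i′) (setCell-here c a′ i b))
            (trans (set-≢ (c a′) b i′≢i) (sym (trans (lookup∘update′ (i′≢i ∘ cong proj₂ ∘ cell-injective) (encode c) b) (view-encode c a′ i′))))
    pointwise a′ i′ (no a′≢a) _ =
      trans (cong (λ φ → φ i′) (setCell-there c i b a′≢a))
            (sym (trans (lookup∘update′ (a′≢a ∘ cong proj₁ ∘ cell-injective) (encode c) b) (view-encode c a′ i′)))

  record _⇝_ (c d : Board) : Set where
    constructor reaches
    field path : Star (Jump H) (encode c) (encode d)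

  ⇝-reflexive : ∀ {c d} → (∀ a → c a ≗ d a) → c ⇝ d
  ⇝-reflexive c≈d = reaches (subst (Star (Jump H) _) (encode-cong c≈d) ε)

  _▸_ : ∀ {c d e} → c ⇝ d → d ⇝ e → c ⇝ e
  reaches p ▸ reaches q = reaches (p ◅◅ q)

  infixr 5 _▸_

  ⇝-jump : ∀ c {a i b j d l} → Adjacent (a , i) (b , j) → Adjacent (b , j) (d , l) → (a , i) ≢ (d , l) →
           c a i ≡ true → c b j ≡ true → c d l ≡ false →
           c ⇝ setCell (setCell (setCell c a i false) b j false) d l true
  ⇝-jump c {a} {i} {b} {j} {d} {l} ai~bj bj~dl ai≢dl cai cbj cdl =
    reaches (subst (Star (Jump H) (encode c)) result
      (jump x y z (Adj-cell ai~bj , Adj-cell bj~dl , ai≢dl ∘ cell-injective , occupied cai , occupied cbj , vacant) ◅ ε))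
    where
    x = cell a i
    y = cell b j
    z = cell d l
    occupied : ∀ {e f} → c e f ≡ true → cell e f ∈ encode c
    occupied {e} {f} cef = lookup⇒[]= (cell e f) (encode c) (trans (view-encode c e f) cef)
    vacant : cell d l ∉ encode c
    vacant z∈c = contradiction (trans (sym ([]=⇒lookup z∈c)) (trans (view-encode c d l) cdl)) λ ()
    c₁ = setCell c a i false
    c₂ = setCell c₁ b j false
    result : ((encode c [ x ]≔ outside) [ y ]≔ outside) [ z ]≔ inside ≡ encode (setCell c₂ d l true)
    result = sym (begin
      encode (setCell c₂ d l true)                              ≡⟨ encode-setCell c₂ d l true ⟩
      encode c₂ [ z ]≔ inside                                   ≡⟨ cong (_[ z ]≔ inside) (encode-setCell c₁ b j false) ⟩
      (encode c₁ [ y ]≔ outside) [ z ]≔ inside                  ≡⟨ cong (λ S → (S [ y ]≔ outside) [ z ]≔ inside) (encode-setCell c a i false) ⟩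
      ((encode c [ x ]≔ outside) [ y ]≔ outside) [ z ]≔ inside  ∎)
      where open ≡-Reasoning

  setCell-here≗ : ∀ c a {φ} i b → c a ≗ φ → setCell c a i b a ≗ set φ i b
  setCell-here≗ c a i b ca≗φ z = trans (cong (λ ψ → ψ z) (setCell-here c a i b)) (set-cong ca≗φ i b z)

  setCell-there≗ : ∀ c {a v φ} i b → v ≢ a → c v ≗ φ → setCell c a i b v ≗ φ
  setCell-there≗ c i b v≢a cv≗φ z = trans (cong (λ ψ → ψ z) (setCell-there c i b v≢a)) (cv≗φ z)

  -- Moves inside a fibre and across an edge

  record Move (c : Board) (u w : V) : Set where
    constructor move
    field
      board : Board
      reach : c ⇝ board
      frame : ∀ v → v ≢ u → v ≢ w → board v ≗ c v
  open Move public

  Move-trans : ∀ {c u w} (μ : Move c u w) → Move (board μ) u w → Move c u w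
  Move-trans μ ν = move (board ν) (reach μ ▸ reach ν) λ v v≢u v≢w z → trans (frame ν v v≢u v≢w z) (frame μ v v≢u v≢w z)

  _⟶_ : Fibre → Fibre → Set
  φ ⟶ ψ = ∀ c u → c u ≗ φ → Σ (Move c u u) λ μ → board μ u ≗ ψ

  _⟹_ : Fibre × Fibre → Fibre × Fibre → Set
  (φ , χ) ⟹ (ψ , ω) = ∀ c {u w} → Adj G u w → c u ≗ φ → c w ≗ χ →
                        Σ (Move c u w) λ μ → board μ u ≗ ψ × board μ w ≗ ω

  infix 4 _⟶_ _⟹_
  infixr 5 _⨾_

  stay : ∀ c u w → Move c u w
  stay c u w = move c (⇝-reflexive λ _ _ → refl) λ _ _ _ _ → refl

  ≗⇒⟶ : ∀ {φ ψ} → φ ≗ ψ → φ ⟶ ψ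
  ≗⇒⟶ φ≗ψ c u cu≗φ = stay c u u , λ z → trans (cu≗φ z) (φ≗ψ z)

  ⟶-trans : ∀ {φ ψ ω} → φ ⟶ ψ → ψ ⟶ ω → φ ⟶ ω
  ⟶-trans φ⟶ψ ψ⟶ω c u cu≗φ =
    let μ , μu≗ψ = φ⟶ψ c u cu≗φ
        ν , νu≗ω = ψ⟶ω (board μ) u μu≗ψ
    in Move-trans μ ν , νu≗ω

  ≗⇒⟹ : ∀ {φ χ ψ ω} → φ ≗ ψ → χ ≗ ω → (φ , χ) ⟹ (ψ , ω)
  ≗⇒⟹ φ≗ψ χ≗ω c {u} {w} _ cu≗φ cw≗χ =
    stay c u w , (λ z → trans (cu≗φ z) (φ≗ψ z)) , λ z → trans (cw≗χ z) (χ≗ω z)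

  _⨾_ : ∀ {φ χ ψ ω φ′ χ′} → (φ , χ) ⟹ (ψ , ω) → (ψ , ω) ⟹ (φ′ , χ′) → (φ , χ) ⟹ (φ′ , χ′)
  (first ⨾ second) c uw cu cw =
    let μ , μu , μw = first c uw cu cw
        ν , νu , νw = second (board μ) uw μu μw
    in Move-trans μ ν , νu , νw

  ⟹-swap : ∀ {φ χ ψ ω} → (φ , χ) ⟹ (ψ , ω) → (χ , φ) ⟹ (ω , ψ)
  ⟹-swap φχ⟹ψω c uw cu cw =
    let μ , μw , μu = φχ⟹ψω c (adj-sym uw) cw cu
    in move (board μ) (reach μ) (λ v v≢u v≢w → frame μ v v≢w v≢u) , μu , μw

  within₁ : ∀ {φ ψ χ} → φ ⟶ ψ → (φ , χ) ⟹ (ψ , χ)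
  within₁ φ⟶ψ c {u} {w} uw cu cw =
    let μ , μu = φ⟶ψ c u cu
    in move (board μ) (reach μ) (λ v v≢u _ → frame μ v v≢u v≢u) , μu ,
       λ z → trans (frame μ w (adj≢ uw ∘ sym) (adj≢ uw ∘ sym) z) (cw z)

  within₂ : ∀ {φ χ ω} → χ ⟶ ω → (φ , χ) ⟹ (φ , ω)
  within₂ χ⟶ω = ⟹-swap (within₁ χ⟶ω)

  jump-within : ∀ {φ i j l} → i ≢ j → j ≢ l → i ≢ l → φ i ≡ true → φ j ≡ true → φ l ≡ false →
                φ ⟶ φ ⊖ i ⊖ j ⊕ l
  jump-within {i = i} {j} {l} i≢j j≢l i≢l φi φj φl c u cu =
    move _ (⇝-jump c (inj₁ (refl , i≢j)) (inj₁ (refl , j≢l)) (i≢l ∘ cong proj₂) (trans (cu i) φi) (trans (cu j) φj) (trans (cu l) φl))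
      (λ v v≢u _ → setCell-there≗ c₂ l true v≢u (setCell-there≗ c₁ j false v≢u (setCell-there≗ c i false v≢u λ _ → refl))) ,
    setCell-here≗ c₂ u l true (setCell-here≗ c₁ u j false (setCell-here≗ c u i false cu))
    where
    c₁ = setCell c u i false
    c₂ = setCell c₁ u j false

  -- cross-turn jumps (u,i) over (w,i) into (w,l); turn-cross jumps (u,i) over (u,j) into (w,j).
  cross-turn : ∀ {φ χ i l} → i ≢ l → φ i ≡ true → χ i ≡ true → χ l ≡ false →
               (φ , χ) ⟹ (φ ⊖ i , χ ⊖ i ⊕ l)
  cross-turn {i = i} {l} i≢l φi χi χl c {u} {w} uw cu cw =
    move _ (⇝-jump c (inj₂ (refl , uw)) (inj₁ (refl , i≢l)) (adj≢ uw ∘ cong proj₁) (trans (cu i) φi) (trans (cw i) χi) (trans (cw l) χl))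
      (λ v v≢u v≢w → setCell-there≗ c₂ l true v≢w (setCell-there≗ c₁ i false v≢w (setCell-there≗ c i false v≢u λ _ → refl))) ,
    setCell-there≗ c₂ l true u≢w (setCell-there≗ c₁ i false u≢w (setCell-here≗ c u i false cu)) ,
    setCell-here≗ c₂ w l true (setCell-here≗ c₁ w i false (setCell-there≗ c i false (u≢w ∘ sym) cw))
    where
    u≢w = adj≢ uw
    c₁ = setCell c u i false
    c₂ = setCell c₁ w i false

  turn-cross : ∀ {φ χ i j} → i ≢ j → φ i ≡ true → φ j ≡ true → χ j ≡ false →
               (φ , χ) ⟹ (φ ⊖ i ⊖ j , χ ⊕ j)
  turn-cross {i = i} {j} i≢j φi φj χj c {u} {w} uw cu cw =
    move _ (⇝-jump c (inj₁ (refl , i≢j)) (inj₂ (refl , uw)) (adj≢ uw ∘ cong proj₁) (trans (cu i) φi) (trans (cu j) φj) (trans (cw j) χj))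
      (λ v v≢u v≢w → setCell-there≗ c₂ j true v≢w (setCell-there≗ c₁ j false v≢u (setCell-there≗ c i false v≢u λ _ → refl))) ,
    setCell-there≗ c₂ j true u≢w (setCell-here≗ c₁ u j false (setCell-here≗ c u i false cu)) ,
    setCell-here≗ c₂ w j true (setCell-there≗ c₁ j false (u≢w ∘ sym) (setCell-there≗ c i false (u≢w ∘ sym) cw))
    where
    u≢w = adj≢ uw
    c₁ = setCell c u i false
    c₂ = setCell c₁ u j false

  -- Two pegs jump into q at the very end; before that, pairs of pegs jump into another hole.
  collapse : ∀ f {φ} q → count φ ≡ 2 + f → φ q ≡ false → f ≡ 0 ⊎ (∃[ h ] h ≢ q × φ h ≡ false) → φ ⟶ one q
  collapse f {φ} q cφ φq other with two-pegs φ (subst (2 ≤_) (sym cφ) (s≤s (s≤s z≤n)))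
  ... | i , j , i≢j , φi , φj with f | other | suc-injective (suc-injective (trans (sym (count-⊖⊖ φ i≢j φi φj)) cφ))
  ...   | zero | _ | count≡0 = ⟶-trans (jump-within i≢j (peg≢hole φ φj φq) (peg≢hole φ φi φq) φi φj φq) (≗⇒⟶ emptied)
    where
    emptied : φ ⊖ i ⊖ j ⊕ q ≗ one q
    emptied z with z ≟ q
    ... | yes _ = refl
    ... | no _  = count≡0⇒hole (φ ⊖ i ⊖ j) count≡0 z
  ...   | suc f | inj₂ (h , h≢q , φh) | count≡suc-f =
    ⟶-trans (jump-within i≢j (peg≢hole φ φj φh) (peg≢hole φ φi φh) φi φj φh)
            (collapse f q (trans (count-⊕ (φ ⊖ i ⊖ j) h (⊖-hole (φ ⊖ i) j h (⊖-hole φ i h φh))) (cong suc count≡suc-f)) ψq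
                      (inj₂ (i , peg≢hole φ φi φq , ψi)))
    where
    ψq : (φ ⊖ i ⊖ j ⊕ h) q ≡ false
    ψq = trans (set-≢ (φ ⊖ i ⊖ j) true (h≢q ∘ sym)) (⊖-hole (φ ⊖ i) j q (⊖-hole φ i q φq))
    ψi : (φ ⊖ i ⊖ j ⊕ h) i ≡ false
    ψi = trans (set-≢ (φ ⊖ i ⊖ j) true (peg≢hole φ φi φh)) (⊖-hole (φ ⊖ i) j i (set-≡ φ i false))

  -- For k = 3 removing x and third x t leaves just t; for k ≥ 4 the remaining pegs collapse onto t.
  pairing : ∀ {x t} → x ≢ t → ∃[ s ] s ≢ x × (full ⊖ x ⊖ s ⟶ one t)
  pairing {x} {t} x≢t with count (full ⊖ x ⊖ t) in c≡ | count-full⊖⊖ {k} x≢t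
  ... | zero        | ()
  ... | suc zero    | _ = s , third≢ˡ x t , ≗⇒⟶ (count≡1⇒one (full ⊖ x ⊖ s) c≡1 t-remains)
    where
    s = third x t
    c≡1 : count (full ⊖ x ⊖ s) ≡ 1
    c≡1 = trans (suc-injective (suc-injective (trans (count-full⊖⊖ {k} (third≢ˡ x t ∘ sym)) (sym (count-full⊖⊖ {k} x≢t))))) c≡
    t-remains : (full ⊖ x ⊖ s) t ≡ true
    t-remains = trans (set-≢ (full ⊖ x) false (third≢ʳ x t ∘ sym)) (set-≢ full false (x≢t ∘ sym))
  ... | suc (suc f) | _ =
    t , (x≢t ∘ sym) , collapse f t c≡ (set-≡ (full ⊖ x) t false) (inj₂ (x , x≢t , ⊖-hole (full ⊖ x) t x (set-≡ full x false)))

  -- For k ≥ 4 the initial hole is not t: one jump into it leaves the two holes collapse needs.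
  root-collapse : ∀ t → ∃[ h ] full ⊖ h ⟶ one t
  root-collapse t with count (full ⊖ t) in c≡ | count-full⊖ {k} t
  ... | zero              | ()
  ... | suc zero          | ()
  ... | suc (suc zero)    | _ = t , collapse 0 t c≡ (set-≡ full t false) (inj₁ refl)
  ... | suc (suc (suc f)) | _ =
    h , ⟶-trans (jump-within t≢p p≢h t≢h (set-≢ full false t≢h) (set-≢ full false (p≢h)) (set-≡ full h false))
                (collapse f t cψ ψt (inj₂ (p , p≢t , ψp)))
    where
    h = other t
    p = third t h
    t≢h = other≢ t ∘ sym
    p≢h = third≢ʳ t h
    p≢t = third≢ˡ t h
    t≢p = p≢t ∘ sym
    ψ = full ⊖ h ⊖ t ⊖ p ⊕ h
    ψt : ψ t ≡ false
    ψt = trans (set-≢ (full ⊖ h ⊖ t ⊖ p) true t≢h) (⊖-hole (full ⊖ h ⊖ t) p t (set-≡ (full ⊖ h) t false))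
    ψp : ψ p ≡ false
    ψp = trans (set-≢ (full ⊖ h ⊖ t ⊖ p) true p≢h) (set-≡ (full ⊖ h ⊖ t) p false)
    removed : 3 + f ≡ 2 + count (full ⊖ h ⊖ t ⊖ p)
    removed = begin
      3 + f                          ≡⟨ c≡ ⟨
      count (full ⊖ t)               ≡⟨ suc-injective (trans (count-full⊖ {k} t) (sym (count-full⊖ {k} h))) ⟩
      count (full ⊖ h)               ≡⟨ count-⊖⊖ (full ⊖ h) t≢p (set-≢ full false t≢h) (set-≢ full false p≢h) ⟩
      2 + count (full ⊖ h ⊖ t ⊖ p)   ∎
      where open ≡-Reasoning
    cψ : count ψ ≡ 2 + f
    cψ = trans (count-⊕ (full ⊖ h ⊖ t ⊖ p) h (⊖-hole (full ⊖ h ⊖ t) p h (⊖-hole (full ⊖ h) t h (set-≡ full h false))))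
               (suc-injective (sym removed))

  transfer : ∀ {φ i l} → i ≢ l → φ i ≡ true → (φ , one i) ⟹ (φ ⊖ i , one l)
  transfer {i = i} {l} i≢l φi =
    cross-turn i≢l φi (one-≡ i) (one-≢ (i≢l ∘ sym)) ⨾ ≗⇒⟹ (λ _ → refl) (one-shift i l)

  enter-recolour : ∀ {m t} → t ≢ m → (full , one m) ⟹ (one t , one m)
  enter-recolour t≢m =
    let s , s≢m , collapse-to-t = pairing (t≢m ∘ sym)
    in transfer (s≢m ∘ sym) refl ⨾ transfer s≢m (set-≢ full false s≢m) ⨾ within₁ collapse-to-t

  enter-share : ∀ {m} → (full , one m) ⟹ (one m , two m (other m))
  enter-share {m} =
    let s , s≢x , collapse-to-m = pairing (other≢ m)
    in turn-cross s≢x refl refl (one-≢ (other≢ m))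
       ⨾ within₁ (⟶-trans (≗⇒⟶ (⊖-comm full s (other m))) collapse-to-m)

  leave-empty : ∀ m₂ m → (one m₂ , two m (other m)) ⟹ (empty , one m)
  leave-empty m₂ m with m₂ ≟ m
  ... | yes refl =
    ⟹-swap (transfer (x≢m ∘ sym) (two-fst m x)) ⨾ ≗⇒⟹ (λ _ → refl) (two-⊖ x≢m)
    ⨾ transfer x≢m (one-≡ x) ⨾ ≗⇒⟹ (one-⊖ x) (λ _ → refl)
    where
    x = other m
    x≢m = other≢ m
  ... | no m₂≢m =
    ⟹-swap (turn-cross x≢m (set-≡ (one m) x true) (two-fst m x) (one-≢ (m₂≢m ∘ sym)))
    ⨾ turn-cross m₂≢m (trans (set-≢ (one m₂) true m₂≢m) (one-≡ m₂)) (set-≡ (one m₂) m true) (set-≡ (two m x ⊖ x) m false)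
    ⨾ ≗⇒⟹ emptied refilled
    where
    x = other m
    x≢m = other≢ m
    emptied : one m₂ ⊕ m ⊖ m₂ ⊖ m ≗ empty
    emptied z with z ≟ m | z ≟ m₂
    ... | yes _ | _     = refl
    ... | no _  | yes _ = refl
    ... | no _  | no _  = refl
    refilled : two m x ⊖ x ⊖ m ⊕ m ≗ one m
    refilled z with z ≟ m | z ≟ x
    ... | yes _ | _     = refl
    ... | no _  | yes _ = refl
    ... | no _  | no _  = refl

  leave-matched : ∀ {m x} → x ≢ m → two m x ⟶ one (third m x)
  leave-matched {m} {x} x≢m =
    ⟶-trans (jump-within (x≢m ∘ sym) (third≢ʳ m x ∘ sym) (third≢ˡ m x ∘ sym) (two-fst m x) (set-≡ (one m) x true) φy)
            (≗⇒⟶ moved)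
    where
    y = third m x
    φy : two m x y ≡ false
    φy = trans (set-≢ (one m) true (third≢ʳ m x)) (one-≢ (third≢ˡ m x))
    moved : two m x ⊖ m ⊖ x ⊕ y ≗ one y
    moved z with z ≟ y | z ≟ x | z ≟ m
    ... | yes _ | _     | _     = refl
    ... | no _  | yes _ | _     = refl
    ... | no _  | no _  | yes _ = refl
    ... | no _  | no _  | no _  = refl

  module Sweeping (T : Board)
    (shape  : ∀ a → T a ≗ empty ⊎ ∃[ t ] T a ≗ one t)
    (proper : ∀ {a b t} → Adj G a b → T a t ≡ true → T b t ≡ false)
    where

    -- The result of exploring from u, holding the single peg m, when the vertices in Vs are visited.
    record Sweep (Vs : V → Bool) (c : Board) (u : V) (m : C) : Set where
      field
        seen      : V → Bool
        outcome   : Board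
        walk      : c ⇝ outcome
        grows     : ∀ v → Vs v ≡ true → seen v ≡ true
        finished  : ∀ v → Vs v ≡ false → seen v ≡ true → outcome v ≗ T v
        untouched : ∀ v → seen v ≡ false → outcome v ≗ c v
        settled   : ∀ v → Vs v ≡ true → v ≢ u → outcome v ≗ c v
        closed    : ∀ v y → Vs v ≡ false → seen v ≡ true → Adj G v y → seen y ≡ true
        colour    : C
        holds     : outcome u ≗ one colour
        keeps     : T u m ≡ true → colour ≡ m
    open Sweep

    Sweep-refl : ∀ {Vs c u m} → c u ≗ one m → Sweep Vs c u m
    Sweep-refl {Vs} {c} {m = m} cu = record
      { seen = Vs ; outcome = c ; walk = ⇝-reflexive λ _ _ → refl ; grows = λ _ Vv → Vv
      ; finished = λ v Vv Vv′ → contradiction (trans (sym Vv′) Vv) λ ()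
      ; untouched = λ _ _ _ → refl ; settled = λ _ _ _ _ → refl
      ; closed = λ v _ Vv Vv′ → contradiction (trans (sym Vv′) Vv) λ ()
      ; colour = m ; holds = cu ; keeps = λ _ → refl }

    Sweep-trans : ∀ {Vs c u m} → Vs u ≡ true → (s : Sweep Vs c u m) → Sweep (seen s) (outcome s) u (colour s) → Sweep Vs c u m
    Sweep-trans {Vs} {c} {u} Vu s r = record
      { seen = seen r ; outcome = outcome r ; walk = walk s ▸ walk r
      ; grows = λ v Vv → grows r v (grows s v Vv)
      ; finished = finished′ ; untouched = untouched′
      ; settled = λ v Vv v≢u z → trans (settled r v (grows s v Vv) v≢u z) (settled s v Vv v≢u z)
      ; closed = closed′
      ; colour = colour r ; holds = holds r
      ; keeps = λ Tum → let colour-s≡m = keeps s Tum in trans (keeps r (subst (λ i → T u i ≡ true) (sym colour-s≡m) Tum)) colour-s≡m }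
      where
      finished′ : ∀ v → Vs v ≡ false → seen r v ≡ true → outcome r v ≗ T v
      finished′ v Vv Rv with seen s v in Sv
      ... | true  = λ z → trans (settled r v Sv (peg≢hole Vs Vu Vv ∘ sym) z) (finished s v Vv Sv z)
      ... | false = finished r v Sv Rv
      untouched′ : ∀ v → seen r v ≡ false → outcome r v ≗ c v
      untouched′ v Rv z = trans (untouched r v Rv z) (untouched s v (contraposeᵇ (grows r v) Rv) z)
      closed′ : ∀ v y → Vs v ≡ false → seen r v ≡ true → Adj G v y → seen r y ≡ true
      closed′ v y Vv Rv vy with seen s v in Sv
      ... | true  = grows r y (closed s v y Vv Sv vy)
      ... | false = closed r v y Sv Rv vy

    -- How a parent u holding the single peg m visits its full child x: enter gives x a single peg,
    -- leave turns x into its target once the subtree of x is done.  If that target is m, the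
    -- parent has to give up m, which is harmless since then T u m is false.
    record Plan (x u : V) (m : C) : Set where
      field
        entry  : C
        parent : Fibre
        enter  : (full , one m) ⟹ (one entry , parent)
        leave  : ∀ m₂ → (T x entry ≡ true → m₂ ≡ entry) →
                 ∃[ m₃ ] ((one m₂ , parent) ⟹ (T x , one m₃)) × (T u m ≡ true → m₃ ≡ m)

    plan : ∀ {x u} m → Adj G x u → Plan x u m
    plan {x} {u} m xu with shape x
    ... | inj₁ Tx≗empty = record
      { entry = m ; parent = two m (other m) ; enter = enter-share
      ; leave = λ m₂ _ → m , leave-empty m₂ m ⨾ ≗⇒⟹ (sym ∘ Tx≗empty) (λ _ → refl) , λ _ → refl }
    ... | inj₂ (t , Tx≗t) = single (t ≟ m)
      where
      Txt : T x t ≡ true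
      Txt = trans (Tx≗t t) (one-≡ t)
      arrived : ∀ {m₂} → (T x t ≡ true → m₂ ≡ t) → one m₂ ≗ T x
      arrived keeps z = trans (cong (λ i → one i z) (keeps Txt)) (sym (Tx≗t z))
      single : Dec (t ≡ m) → Plan x u m
      single (no t≢m) = record
        { entry = t ; parent = one m ; enter = enter-recolour t≢m
        ; leave = λ _ keeps → m , ≗⇒⟹ (arrived keeps) (λ _ → refl) , λ _ → refl }
      single (yes refl) = record
        { entry = t ; parent = two t (other t) ; enter = enter-share
        ; leave = λ _ keeps → third t (other t)
                            , ≗⇒⟹ (arrived keeps) (λ _ → refl) ⨾ within₂ (leave-matched (other≢ t))
                            , λ Tut → contradiction (trans (sym Txt) (proper (adj-sym xu) Tut)) λ () }

    Explored : (V → Bool) → Board → V → C → List V → Set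
    Explored Vs c u m xs = Σ (Sweep Vs c u m) λ s → ∀ x → x ∈ₗ xs → Adj G u x → seen s x ≡ true

    Unseen-full : (V → Bool) → Board → Set
    Unseen-full Vs c = ∀ v → Vs v ≡ false → c v ≗ full

    child-sweep : ∀ {Vs c x u m} (p : Plan x u m) → Adj G x u → Vs x ≡ false → Vs u ≡ true →
                  (μ : Move c x u) → board μ x ≗ one (Plan.entry p) → board μ u ≗ Plan.parent p →
                  Explored (Vs ⊕ x) (board μ) x (Plan.entry p) (allFin _) →
                  Σ (Sweep Vs c u m) λ s → seen s x ≡ true
    child-sweep {Vs} {c} {x} {u} p xu Vx Vu μ μx μu (e , x-closed)
      with Plan.leave p (colour e) (keeps e)
    ... | m₃ , exit , keeps′
      with exit (outcome e) xu (holds e) (λ z → trans (settled e u (⊕-peg Vs x u Vu) (adj≢ xu ∘ sym) z) (μu z))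
    ... | ν , νx , νu = record
      { seen = seen e ; outcome = board ν ; walk = reach μ ▸ walk e ▸ reach ν
      ; grows = λ v Vv → grows e v (⊕-peg Vs x v Vv)
      ; finished = finished′ ; untouched = untouched′
      ; settled = λ v Vv v≢u z → let v≢x = peg≢hole Vs Vv Vx in
          trans (frame ν v v≢x v≢u z) (trans (settled e v (⊕-peg Vs x v Vv) v≢x z) (frame μ v v≢x v≢u z))
      ; closed = closed′
      ; colour = m₃ ; holds = νu ; keeps = keeps′ } , Sx
      where
      Sx : seen e x ≡ true
      Sx = grows e x (set-≡ Vs x true)
      finished′ : ∀ v → Vs v ≡ false → seen e v ≡ true → board ν v ≗ T v
      finished′ v Vv Sv with v ≟ x
      ... | yes refl = νx
      ... | no v≢x   = λ z → trans (frame ν v v≢x (peg≢hole Vs Vu Vv ∘ sym) z) (finished e v (trans (set-≢ Vs true v≢x) Vv) Sv z)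
      untouched′ : ∀ v → seen e v ≡ false → board ν v ≗ c v
      untouched′ v Sv z =
        let v≢x = peg≢hole (seen e) Sx Sv ∘ sym
            v≢u = peg≢hole (seen e) (grows e u (⊕-peg Vs x u Vu)) Sv ∘ sym
        in trans (frame ν v v≢x v≢u z) (trans (untouched e v Sv z) (frame μ v v≢x v≢u z))
      closed′ : ∀ v y → Vs v ≡ false → seen e v ≡ true → Adj G v y → seen e y ≡ true
      closed′ v y Vv Sv vy with v ≟ x
      ... | yes refl = x-closed y (∈-allFin y) vy
      ... | no v≢x   = closed e v y (trans (set-≢ Vs true v≢x) Vv) Sv vy

    unseen : (V → Bool) → ℕ
    unseen Vs = count (not ∘ Vs)

    unseen-⊕ : ∀ Vs x → Vs x ≡ false → unseen Vs ≡ suc (unseen (Vs ⊕ x))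
    unseen-⊕ Vs x Vx = trans (count-⊖ (not ∘ Vs) x (cong not Vx)) (cong suc (count-cong flip))
      where
      flip : (not ∘ Vs) ⊖ x ≗ not ∘ (Vs ⊕ x)
      flip z with z ≟ x
      ... | yes _ = refl
      ... | no _  = refl

    unseen-mono : ∀ {Vs Vs′} → (∀ v → Vs v ≡ true → Vs′ v ≡ true) → unseen Vs′ ≤ unseen Vs
    unseen-mono Vs⊆Vs′ = count-mono λ v unseen′ → cong not (contraposeᵇ (Vs⊆Vs′ v) (not-injective unseen′))

    skip : ∀ {Vs c u m x xs} → ¬ Adj G u x ⊎ Vs x ≡ true → Explored Vs c u m xs → Explored Vs c u m (x ∷ xs)
    skip {Vs} {u = u} {x = x} {xs} done (s , xs-seen) = s , seen-all
      where
      x-seen : ¬ Adj G u x ⊎ Vs x ≡ true → Adj G u x → seen s x ≡ true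
      x-seen (inj₁ ¬ux) ux = contradiction ux ¬ux
      x-seen (inj₂ Vx)  _  = grows s x Vx
      seen-all : ∀ y → y ∈ₗ x ∷ xs → Adj G u y → seen s y ≡ true
      seen-all y (here refl) uy = x-seen done uy
      seen-all y (there y∈xs) uy = xs-seen y y∈xs uy

    extend : ∀ {Vs c u m x xs} → Vs u ≡ true → (s : Sweep Vs c u m) → seen s x ≡ true →
             Explored (seen s) (outcome s) u (colour s) xs → Explored Vs c u m (x ∷ xs)
    extend {x = x} {xs} Vu s Sx (r , xs-seen) = Sweep-trans Vu s r , seen-all
      where
      seen-all : ∀ y → y ∈ₗ x ∷ xs → Adj G _ y → seen r y ≡ true
      seen-all y (here refl)  _  = grows r y Sx
      seen-all y (there y∈xs) uy = xs-seen y y∈xs uy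

    mutual
      explore : ∀ f Vs c u m xs → Vs u ≡ true → c u ≗ one m → Unseen-full Vs c → unseen Vs ≤ f → Explored Vs c u m xs
      explore f Vs c u m []       Vu cu fresh fuel = Sweep-refl cu , λ _ ()
      explore f Vs c u m (x ∷ xs) Vu cu fresh fuel = explore-at f Vs c u m x xs (adj-dec u x) (Vs x) refl Vu cu fresh fuel

      explore-at : ∀ f Vs c u m x xs → Adj G u x ⊎ ¬ Adj G u x → (b : Bool) → Vs x ≡ b →
                   Vs u ≡ true → c u ≗ one m → Unseen-full Vs c → unseen Vs ≤ f → Explored Vs c u m (x ∷ xs)
      explore-at f Vs c u m x xs (inj₂ ¬ux) _ _ Vu cu fresh fuel =
        skip (inj₁ ¬ux) (explore f Vs c u m xs Vu cu fresh fuel)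
      explore-at f Vs c u m x xs (inj₁ _) true Vx Vu cu fresh fuel =
        skip (inj₂ Vx) (explore f Vs c u m xs Vu cu fresh fuel)
      explore-at zero Vs c u m x xs (inj₁ _) false Vx Vu cu fresh fuel =
        contradiction (trans (sym (unseen-⊕ Vs x Vx)) (n≤0⇒n≡0 fuel)) λ ()
      explore-at f@(suc f′) Vs c u m x xs (inj₁ ux) false Vx Vu cu fresh fuel =
        let s , Sx = visit-child f′ Vs c x u m (adj-sym ux) Vx Vu (fresh x Vx) cu fresh
                       (≤-pred (subst (_≤ f) (unseen-⊕ Vs x Vx) fuel))
        in extend Vu s Sx (explore f (seen s) (outcome s) u (colour s) xs (grows s u Vu) (holds s)
                             (λ v Sv z → trans (untouched s v Sv z) (fresh v (contraposeᵇ (grows s v) Sv) z))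
                             (≤-trans (unseen-mono (grows s)) fuel))

      visit-child : ∀ f Vs c x u m → Adj G x u → Vs x ≡ false → Vs u ≡ true → c x ≗ full → c u ≗ one m →
                    Unseen-full Vs c → unseen (Vs ⊕ x) ≤ f → Σ (Sweep Vs c u m) λ s → seen s x ≡ true
      visit-child f Vs c x u m xu Vx Vu cx cu fresh fuel with plan m xu
      ... | p with Plan.enter p c xu cx cu
      ... | μ , μx , μu =
        child-sweep p xu Vx Vu μ μx μu
          (explore f (Vs ⊕ x) (board μ) x (Plan.entry p) (allFin _) (set-≡ Vs x true) μx fresh′ fuel)
        where
        fresh′ : Unseen-full (Vs ⊕ x) (board μ)
        fresh′ v Vv z =
          let v≢x = peg≢hole (Vs ⊕ x) (set-≡ Vs x true) Vv ∘ sym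
              v≢u = peg≢hole (Vs ⊕ x) (⊕-peg Vs x u Vu) Vv ∘ sym
          in trans (frame μ v v≢x v≢u z) (fresh v (trans (sym (set-≢ Vs true v≢x)) Vv) z)

    peg⇒one : ∀ {a t} → T a t ≡ true → T a ≗ one t
    peg⇒one {a} {t} Tat with shape a
    ... | inj₁ Ta≗empty = contradiction (trans (sym Tat) (Ta≗empty t)) λ ()
    ... | inj₂ (t′ , Ta≗t′) with one-true t′ t (trans (sym (Ta≗t′ t)) Tat)
    ...   | refl = Ta≗t′

    sweep-from : Connected G → ∀ {r t} c → T r t ≡ true → c r ≗ one t → (∀ v → v ≢ r → c v ≗ full) → c ⇝ T
    sweep-from conn {r} {t} c Trt cr fresh
      with explore (n G) (one r) c r t (allFin _) (one-≡ r) cr (λ v rv → fresh v (peg≢hole (one r) (one-≡ r) rv ∘ sym)) (count≤n _)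
    ... | s , neighbours-seen = walk s ▸ ⇝-reflexive done
      where
      all-seen : ∀ v → seen s v ≡ true
      all-seen = spread conn step (grows s r (one-≡ r))
        where
        step : ∀ {a b} → Adj G a b → seen s a ≡ true → seen s b ≡ true
        step {a} {b} ab Sa with a ≟ r
        ... | yes refl = neighbours-seen b (∈-allFin b) ab
        ... | no a≢r   = closed s a b (one-≢ a≢r) Sa ab
      done : ∀ v → outcome s v ≗ T v
      done v with v ≟ r
      ... | yes refl = λ z → trans (holds s z) (trans (cong (λ i → one i z) (keeps s Trt)) (sym (peg⇒one Trt z)))
      ... | no v≢r   = finished s v (one-≢ v≢r) (all-seen v)

  -- Terminal states are independent

  module _ {S : Config H} (stuck : ¬ JumpAvailable H S) where

    jammed : ∀ {a i b j d l} → Adjacent (a , i) (b , j) → Adjacent (b , j) (d , l) → (a , i) ≢ (d , l) →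
             view S a i ≡ true → view S b j ≡ true → view S d l ≢ false
    jammed {a} {i} {b} {j} {d} {l} ai~bj bj~dl ai≢dl Sai Sbj Sdl =
      stuck (cell a i , cell b j , cell d l , Adj-cell ai~bj , Adj-cell bj~dl , ai≢dl ∘ cell-injective ,
             view⇒∈ Sai , view⇒∈ Sbj , λ dl∈S → contradiction (trans (sym ([]=⇒lookup dl∈S)) Sdl) λ ())

    Full : V → Set
    Full a = ∀ i → view S a i ≡ true

    full-spreads : ∀ {a b} → Adj G a b → Full a → Full b
    full-spreads ab Fa l = ¬-not (jammed (inj₁ (refl , other≢ l)) (inj₂ (refl , ab)) (adj≢ ab ∘ cong proj₁) (Fa (other l)) (Fa l))

    adjacent-pegs⇒full : ∀ {a i b j} → Adjacent (a , i) (b , j) → view S a i ≡ true → view S b j ≡ true → ∃[ c ] Full c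
    adjacent-pegs⇒full {a} (inj₁ (refl , i≢j)) Sai Saj = a , λ l → ¬-not λ Sal →
      jammed (inj₁ (refl , i≢j)) (inj₁ (refl , peg≢hole (view S a) Saj Sal)) (peg≢hole (view S a) Sai Sal ∘ cong proj₂) Sai Saj Sal
    adjacent-pegs⇒full {b = b} (inj₂ (refl , ab)) Sai Sbi = b , λ l → ¬-not λ Sbl →
      jammed (inj₂ (refl , ab)) (inj₁ (refl , peg≢hole (view S b) Sbi Sbl)) (adj≢ ab ∘ cong proj₁) Sai Sbi Sbl

  terminal⇒independent : Connected G → ∀ {S} → IsTerminalState H S → IsIndependent H S
  terminal⇒independent conn {S} ((v , play) , stuck) x y x∈S y∈S xy =
    let c , Fc = adjacent-pegs⇒full stuck xy (∈⇒view x∈S) (∈⇒view y∈S)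
        p , p∉S = holes-persist play (v , x∈p⇒x∉∁p (x∈⁅x⁆ v))
    in p∉S (subst (_∈ S) (cell-coords p) (view⇒∈ (spread conn (full-spreads stuck) Fc (proj₁ (coords p)) (proj₂ (coords p)))))

  -- Nonempty independent sets are terminal states

  punctured-at : ∀ r h → view (∁ ⁅ cell r h ⁆) r ≗ full ⊖ h
  punctured-at r h z with z ≟ h
  ... | yes refl = ∉⇒view (x∈p⇒x∉∁p (x∈⁅x⁆ (cell r h)))
  ... | no z≢h   = []=⇒lookup (x∉p⇒x∈∁p (z≢h ∘ cong proj₂ ∘ cell-injective ∘ x∈⁅y⁆⇒x≡y (cell r h)))

  punctured-off : ∀ r h {v} → v ≢ r → view (∁ ⁅ cell r h ⁆) v ≗ full
  punctured-off r h v≢r z = []=⇒lookup (x∉p⇒x∈∁p (v≢r ∘ cong proj₁ ∘ cell-injective ∘ x∈⁅y⁆⇒x≡y (cell r h)))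

  module _ {S : Config H} (independent : IsIndependent H S) where

    fibre-shape : ∀ a → view S a ≗ empty ⊎ ∃[ t ] view S a ≗ one t
    fibre-shape a with any? (λ i → view S a i ≟ᵇ true)
    ... | yes (t , Sat) = inj₂ (t , single)
      where
      single : view S a ≗ one t
      single z with z ≟ t
      ... | yes refl = Sat
      ... | no z≢t   = ¬-not λ Saz → independent _ _ (view⇒∈ Saz) (view⇒∈ Sat) (Adj-cell (inj₁ (refl , z≢t)))
    ... | no none = inj₁ λ i → ¬-not λ Sai → none (i , Sai)

    colours-differ : ∀ {a b t} → Adj G a b → view S a t ≡ true → view S b t ≡ false
    colours-differ ab Sat = ¬-not λ Sbt → independent _ _ (view⇒∈ Sat) (view⇒∈ Sbt) (Adj-cell (inj₂ (refl , ab)))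

    open Sweeping (view S) fibre-shape colours-differ using (sweep-from)

    independent⇒terminal : Connected G → ∀ {r t} → view S r t ≡ true → IsTerminalState H S
    independent⇒terminal conn {r} {t} Srt with root-collapse t
    ... | h , collapse-root with collapse-root (view (∁ ⁅ cell r h ⁆)) r (punctured-at r h)
    ... | μ , μr = (cell r h , play) , λ (x , y , _ , xy , _ , _ , x∈S , y∈S , _) → independent x y x∈S y∈S xy
      where
      rest-full : ∀ v → v ≢ r → board μ v ≗ full
      rest-full v v≢r z = trans (frame μ v v≢r v≢r z) (punctured-off r h v≢r z)
      play : Star (Jump H) (∁ ⁅ cell r h ⁆) S
      play = subst₂ (Star (Jump H)) (encode-view _) (encode-view S)
               (_⇝_.path (reach μ ▸ sweep-from conn (board μ) Srt μr rest-full))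

  -- Sizes of independent sets

  independent? : ∀ S → Dec (IsIndependent H S)
  independent? S = all? λ x → all? λ y → (x ∈? S) →-dec ((y ∈? S) →-dec ¬? (adjacent? (coords x) (coords y)))
    where
    adjacent? : ∀ x y → Dec (Adjacent x y)
    adjacent? (a , i) (b , j) = ((a ≟ b) ×-dec ¬? (i ≟ j)) ⊎-dec ((i ≟ j) ×-dec adj? (adj-dec a b))
      where
      adj? : Adj G a b ⊎ ¬ Adj G a b → Dec (Adj G a b)
      adj? (inj₁ ab)  = yes ab
      adj? (inj₂ ¬ab) = no ¬ab

  maximum-independent : ∃[ I ] IsIndependent H I × (∀ S → IsIndependent H S → ∣ S ∣ ≤ ∣ I ∣)
  maximum-independent = maximum independent? {⊥} λ _ _ x∈⊥ → contradiction x∈⊥ ∉⊥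

  independent-size : ∀ {S} → IsIndependent H S → ∣ S ∣ ≤ n G
  independent-size {S} independent = subst (_≤ n G) (sym (∣∣≡count S)) (count-blocks≤ (n G) (lookup S) fibre≤1)
    where
    fibre≤1 : ∀ a → count (view S a) ≤ 1
    fibre≤1 a with fibre-shape independent a
    ... | inj₁ empty-fibre = subst (_≤ 1) (sym (trans (count-cong empty-fibre) (count-empty {k}))) z≤n
    ... | inj₂ (t , one-fibre) = subst (_≤ 1) (sym (trans (count-cong one-fibre) (count-one t))) ≤-refl

  colouring⇒independent : ∀ {χ} (f : V → Fin χ) → ProperColoring G χ f → χ ≤ k →
                          ∃[ S ] IsIndependent H S × ∣ S ∣ ≡ n G
  colouring⇒independent f proper χ≤k = encode coloured , independent , size
    where
    colour : V → C
    colour a = inject≤ (f a) χ≤k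
    coloured : Board
    coloured a = one (colour a)
    on-colour : ∀ {x} → x ∈ encode coloured → proj₂ (coords x) ≡ colour (proj₁ (coords x))
    on-colour {x} x∈S = one-true _ _ (trans (sym (uncurry (view-encode coloured) (coords x))) (∈⇒view x∈S))
    independent : IsIndependent H (encode coloured)
    independent x y x∈S y∈S (inj₁ (a≡b , i≢j)) = i≢j (trans (on-colour x∈S) (trans (cong colour a≡b) (sym (on-colour y∈S))))
    independent x y x∈S y∈S (inj₂ (i≡j , ab)) =
      proper _ _ ab (inject≤-injective χ≤k χ≤k _ _ (trans (sym (on-colour x∈S)) (trans i≡j (on-colour y∈S))))
    size : ∣ encode coloured ∣ ≡ n G
    size = trans (∣∣≡count (encode coloured))
                 (count-blocks≡ (n G) (lookup (encode coloured)) λ a → trans (count-cong (view-encode coloured a)) (count-one (colour a)))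

  occupied : NonZero (n G) → ∀ {I} → (∀ S → IsIndependent H S → ∣ S ∣ ≤ ∣ I ∣) → ∃[ r ] ∃[ t ] view I r t ≡ true
  occupied nonzero {I} I-maximum =
    let p , Ip = some-peg (lookup I) (subst (0 <_) (∣∣≡count {n H} I) 0<∣I∣)
    in proj₁ (coords p) , proj₂ (coords p) , trans (cong (lookup I) (cell-coords p)) Ip
    where
    p₀ : Fin (n H)
    p₀ = cell (fromℕ< (>-nonZero⁻¹ (n G) {{nonzero}})) zero
    singleton : IsIndependent H ⁅ p₀ ⁆
    singleton x y x∈ y∈ xy with x∈⁅y⁆⇒x≡y p₀ x∈ | x∈⁅y⁆⇒x≡y p₀ y∈ | xy
    ... | refl | refl | inj₁ (_ , i≢i) = i≢i refl
    ... | refl | refl | inj₂ (_ , aa)  = adj-irrefl aa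
    0<∣I∣ : 0 < ∣ I ∣
    0<∣I∣ = subst (_≤ ∣ I ∣) (∣⁅x⁆∣≡1 p₀) (I-maximum ⁅ p₀ ⁆ singleton)

theorem3p4 : (G : Graph) → IsSimpleGraph G → Connected G →
    (k : ℕ) → 3 ≤ k →
      (∃[ m ] (IsFoolsSolitaireNumber (G □ K k) m × IsIndependenceNumber (G □ K k) m))
      × (∀ χ → IsChromaticNumber G χ → χ ≤ k → IsFoolsSolitaireNumber (G □ K k) (n G))
theorem3p4 G simple conn (suc (suc (suc k′))) (s≤s (s≤s (s≤s z≤n)))
  with Board.maximum-independent G simple k′
... | I , I-independent , I-maximum
  with Board.occupied G simple k′ (proj₁ conn) {I} I-maximum
... | _ , _ , I-occupied = (∣ I ∣ , F≡∣I∣ , α≡∣I∣) , F≡n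
  where
  open Board G simple k′
  F≡∣I∣ : IsFoolsSolitaireNumber H ∣ I ∣
  F≡∣I∣ = (I , independent⇒terminal I-independent conn I-occupied , refl) ,
          λ S S-terminal → I-maximum S (terminal⇒independent conn S-terminal)
  α≡∣I∣ : IsIndependenceNumber H ∣ I ∣
  α≡∣I∣ = (I , I-independent , refl) , I-maximum
  F≡n : ∀ χ → IsChromaticNumber G χ → χ ≤ k → IsFoolsSolitaireNumber H (n G)
  F≡n χ ((f , proper) , _) χ≤k =
    let S , S-independent , ∣S∣≡n = colouring⇒independent f proper χ≤k
    in subst (IsFoolsSolitaireNumber H)
             (≤-antisym (independent-size I-independent) (subst (_≤ ∣ I ∣) ∣S∣≡n (I-maximum S S-independent)))
             F≡∣I∣
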